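{- For every positive integer $n$, the set $\mathscr{C}_{F_{2k}}(n)$ of compositions of $n$ in which each part equal to $k$ comes in $F_{2k}$ colors is in one-to-one correspondence with the set of spanning trees of the $n$-ladder graph $L_n$, and these sets are also equinumerous with the set of words of length $n-1$ over the alphabet $\{0,1,2,3\}$ that do not contain $01$ as a factor (two consecutive letters). These sets are enumerated by the sequence $1,4,15,56,209,780,2911,10864,\dots$, i.e. their common cardinality $a_n$ satisfies $a_1=1$, $a_2=4$, $a_n=4a_{n-1}-a_{n-2}$ for $n\ge3$.
   Context: $F_0=0$, $F_1=1$, $F_n=F_{n-1}+F_{n-2}$ are the Fibonacci numbers. A $w$-colored composition of $n$ (for a sequence $(w_k)$ of nonnegative integers) is a composition $(j_1,\dots,j_m)$ of $n$ together with a choice of one of $w_{j_i}$ colors for each part $j_i$; $\mathscr{C}_{w_k}(n)$ is the set of these. The $n$-ladder graph $L_n$ is the $n\times 2$ grid graph (the Cartesian product of a path on $n$ vertices with a path on $2$ vertices), with $2n$ vertices and $3n-2$ edges; a spanning tree is a set of $2n-1$ edges forming a tree on all vertices. -}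

module Defs where

open import Level using (0ℓ)
open import Data.Nat using (ℕ; zero; suc; _+_; _*_; _∸_; _≤_)
open import Data.Bool using (Bool; true; false)
open import Data.Fin using (Fin; zero; suc; inject₁)
open import Data.Product using (Σ; _×_; _,_; proj₁)
open import Data.Sum using (_⊎_)
open import Data.List using (List; []; _∷_; map; length; _∷ʳ_)
open import Data.Nat.ListAction using (sum)
open import Data.List.Relation.Unary.All using (All)
open import Data.List.Relation.Unary.Linked using (Linked)
open import Data.List.Relation.Unary.Unique.Propositional using (Unique)
open import Data.Vec using (Vec; lookup; toList) renaming ([] to []ᵛ; _∷_ to _∷ᵛ_)
open import Relation.Nullary using (¬_)
open import Relation.Binary using (Setoid)
open import Relation.Binary.PropositionalEquality using (_≡_; refl; sym; trans)

fib : ℕ → ℕ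
fib zero = zero
fib (suc zero) = suc zero
fib (suc (suc n)) = fib (suc n) + fib n

-- The setoid on a Σ-type that identifies elements with equal underlying data
-- (the second component is a proof of a property, not part of the object).
Σ-setoid : (A : Set) (P : A → Set) → Setoid 0ℓ 0ℓ
Σ-setoid A P = record
  { Carrier = Σ A P
  ; _≈_ = λ x y → proj₁ x ≡ proj₁ y
  ; isEquivalence = record { refl = refl ; sym = sym ; trans = trans }
  }

ColoredPart : (ℕ → ℕ) → Set
ColoredPart w = Σ ℕ (λ k → Fin (w k))

IsColoredComp : (w : ℕ → ℕ) → ℕ → List (ColoredPart w) → Set
IsColoredComp w n l = All (λ p → 1 ≤ proj₁ p) l × sum (map proj₁ l) ≡ n

ColoredComps : (ℕ → ℕ) → ℕ → Setoid 0ℓ 0ℓ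
ColoredComps w n = Σ-setoid (List (ColoredPart w)) (IsColoredComp w n)

F2k : ℕ → ℕ
F2k k = fib (2 * k)

-- The ladder graph L_n with n = suc m (vertices Fin n × Fin 2)

Vertex : ℕ → Set
Vertex m = Fin (suc m) × Fin 2

data Edge (m : ℕ) : Set where
  rung : Fin (suc m) → Edge m
  rail : Fin 2 → Fin m → Edge m

record EdgeSet (m : ℕ) : Set where
  constructor edgeSet
  field
    rungs  : Vec Bool (suc m)
    rails0 : Vec Bool m
    rails1 : Vec Bool m
open EdgeSet public

_∈E_ : ∀ {m} → Edge m → EdgeSet m → Set
rung i ∈E S = lookup (rungs S) i ≡ true
rail zero i ∈E S = lookup (rails0 S) i ≡ true
rail (suc zero) i ∈E S = lookup (rails1 S) i ≡ true

ends : ∀ {m} → Edge m → Vertex m × Vertex m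
ends (rung i) = (i , zero) , (i , suc zero)
ends (rail b i) = (inject₁ i , b) , (suc i , b)

Adj : ∀ {m} → EdgeSet m → Vertex m → Vertex m → Set
Adj S u v = Σ (Edge _) λ e → e ∈E S × (ends e ≡ (u , v) ⊎ ends e ≡ (v , u))

data Walk {m} (S : EdgeSet m) : Vertex m → Vertex m → Set where
  here : ∀ {u} → Walk S u u
  step : ∀ {u v w} → Adj S u v → Walk S v w → Walk S u w

Connected : ∀ {m} → EdgeSet m → Set
Connected S = ∀ u v → Walk S u v

Cycle : ∀ {m} → EdgeSet m → Set
Cycle {m} S = Σ (Vertex m) λ x → Σ (List (Vertex m)) λ xs →
  2 ≤ length xs × Unique (x ∷ xs) × Linked (Adj S) ((x ∷ xs) ∷ʳ x)

Acyclic : ∀ {m} → EdgeSet m → Set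
Acyclic S = ¬ Cycle S

trues : ∀ {k} → Vec Bool k → ℕ
trues []ᵛ = 0
trues (true ∷ᵛ v) = suc (trues v)
trues (false ∷ᵛ v) = trues v

size : ∀ {m} → EdgeSet m → ℕ
size S = trues (rungs S) + trues (rails0 S) + trues (rails1 S)

IsSpanningTree : ∀ {m} → EdgeSet m → Set
IsSpanningTree {m} S = size S ≡ 2 * suc m ∸ 1 × Connected S × Acyclic S

SpanningTrees : ℕ → Setoid 0ℓ 0ℓ
SpanningTrees m = Σ-setoid (EdgeSet m) IsSpanningTree

No01 : ∀ {k} → Vec (Fin 4) k → Set
No01 w = Linked (λ a b → ¬ (a ≡ zero × b ≡ suc zero)) (toList w)

Words01 : ℕ → Setoid 0ℓ 0ℓ
Words01 k = Σ-setoid (Vec (Fin 4) k) No01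

-- the sequence 1, 4, 15, 56, 209, ...: a_1 = 1, a_2 = 4, a_n = 4a_{n-1} - a_{n-2}
-- (a_0 is irrelevant and set to 0)
a : ℕ → ℕ
a zero = 0
a (suc zero) = 1
a (suc (suc zero)) = 4
a (suc (suc (suc n))) = 4 * a (suc (suc n)) ∸ a (suc n)

{-# OPTIONS --safe #-}
-- Every set is put in bijection with one family of codes Tree m (n = m + 1),
-- defined together with Forest m by the transfer-matrix recursion
--   Tree (m+1) = 3 Tree m + Forest m,   Forest (m+1) = 2 Tree m + Forest m,
-- so that |Tree m| = a (m+1) and |Forest m| = a (m+1) - a m, which turns into the
-- recurrence a (m+2) = 4 a (m+1) - a m.  On the ladder, Tree and Forest are the
-- spanning trees and the two-tree spanning forests separating the ends of the
-- first rung, built column by column.  An 01-free word is read letter by letter,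
-- Forest being the words not starting with 1.  A colored composition is read cell
-- by cell, a cell either starting a new part or enlarging the first one; the
-- colours follow F(2k+4) = 2 F(2k+2) + F(2k+1) and F(2k+3) = F(2k+2) + F(2k+1).
module Submission where

open import Defs
open import Data.Nat using (ℕ; zero; suc; _+_; _*_; _∸_; _≤_; z≤n; s≤s)
open import Data.Nat.Properties
  using ( ≤-trans; ≤-reflexive; *-suc; m≤n*m; ∸-monoʳ-≤; m+n∸m≡n; m∸n+n≡m; +-assoc; +-cancelʳ-≡
        ; suc-injective; 0≢1+n)
open import Data.Nat.Tactic.RingSolver using (solve-∀)
open import Data.Nat.ListAction using (sum)
open import Data.Bool using (Bool; true; false)
open import Data.Fin using (Fin; zero; suc)
import Data.Fin as Fin
open import Data.Fin.Properties using (+↔⊎; *↔×; 1↔⊤)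
open import Data.Product using (Σ; _×_; _,_; proj₁; proj₂; uncurry)
open import Data.Product.Properties using (≡-dec)
open import Data.Product.Function.NonDependent.Propositional using (_×-↔_)
open import Data.Sum using (_⊎_; inj₁; inj₂)
import Data.Sum as Sum
open import Data.Sum.Function.Propositional using (_⊎-↔_)
open import Data.Unit using (⊤; tt)
open import Data.Empty using (⊥; ⊥-elim)
open import Data.List using (List; []; _∷_; map; _++_; _∷ʳ_; length)
open import Data.List.Properties using (map-∘; map-cong; map-id; ++-assoc; map-++; length-map)
open import Data.List.Relation.Unary.All using (All; []; _∷_)
import Data.List.Relation.Unary.All as All
import Data.List.Relation.Unary.All.Properties as All
open import Data.List.Relation.Unary.Any using (here; there)
open import Data.List.Relation.Unary.AllPairs using ([]; _∷_)
open import Data.List.Relation.Unary.Unique.Propositional using (Unique)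
import Data.List.Relation.Unary.Unique.Propositional.Properties as Unique
open import Data.List.Membership.Propositional using (_∈_)
open import Data.List.Membership.Propositional.Properties using (∈-∃++)
import Data.List.Membership.DecPropositional as Membershipᵈ
open import Data.List.Relation.Unary.Linked using (Linked; []; [-]; _∷_)
import Data.List.Relation.Unary.Linked as Linked
import Data.List.Relation.Unary.Linked.Properties as Linked
open import Data.Vec using (Vec; []; _∷_)
open import Function.Bundles using (Bijection; Inverse; _↔_)
open import Function.Properties.Inverse using (↔-refl; ↔-sym; ↔-trans; Inverse⇒Bijection)
import Function.Properties.Inverse as Inverse
open import Relation.Nullary using (¬_; yes; no)
open import Relation.Binary using (DecidableEquality)
open import Relation.Binary.PropositionalEquality
  using (_≡_; refl; sym; trans; cong; subst; setoid; module ≡-Reasoning)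

a-monotone : ∀ n → a n ≤ a (suc n)
a-monotone zero = z≤n
a-monotone (suc zero) = s≤s z≤n
a-monotone (suc (suc n)) =
  ≤-trans (m≤n*m a₂ 3) (≤-trans (≤-reflexive 3a₂≡4a₂∸a₂) (∸-monoʳ-≤ (4 * a₂) (a-monotone (suc n))))
  where
    a₂ = a (suc (suc n))
    3a₂≡4a₂∸a₂ : 3 * a₂ ≡ 4 * a₂ ∸ a₂
    3a₂≡4a₂∸a₂ = sym (m+n∸m≡n a₂ (3 * a₂))

a-recurrence : ∀ n → a (suc (suc n)) + a n ≡ 4 * a (suc n)
a-recurrence zero = refl
a-recurrence (suc n) = m∸n+n≡m (≤-trans (a-monotone (suc n)) (m≤n*m (a (suc (suc n))) 4))

≡⇒Fin↔ : ∀ {m n} → m ≡ n → Fin m ↔ Fin n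
≡⇒Fin↔ refl = ↔-refl

Fin-linear↔ : ∀ k {x y} {X Y : Set} → X ↔ Fin x → Y ↔ Fin y → ((Fin k × X) ⊎ Y) ↔ Fin (k * x + y)
Fin-linear↔ k X↔Fin Y↔Fin =
  ↔-trans ((↔-trans (↔-refl ×-↔ X↔Fin) (↔-sym *↔×)) ⊎-↔ Y↔Fin) (↔-sym +↔⊎)

mutual
  Tree : ℕ → Set
  Tree zero = ⊤
  Tree (suc m) = (Fin 3 × Tree m) ⊎ Forest m

  Forest : ℕ → Set
  Forest zero = ⊤
  Forest (suc m) = (Fin 2 × Tree m) ⊎ Forest m

-- Junk values, returned by decoders on inputs that encode nothing.
junkTree : ∀ m → Tree m
junkTree zero = tt
junkTree (suc m) = inj₁ (zero , junkTree m)

junkForest : ∀ m → Forest m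
junkForest zero = tt
junkForest (suc m) = inj₂ (junkForest m)

#tree #forest : ℕ → ℕ
#tree zero = 1
#tree (suc m) = 3 * #tree m + #forest m
#forest zero = 1
#forest (suc m) = 2 * #tree m + #forest m

mutual
  Tree↔Fin : ∀ m → Tree m ↔ Fin (#tree m)
  Tree↔Fin zero = ↔-sym 1↔⊤
  Tree↔Fin (suc m) = Fin-linear↔ 3 (Tree↔Fin m) (Forest↔Fin m)

  Forest↔Fin : ∀ m → Forest m ↔ Fin (#forest m)
  Forest↔Fin zero = ↔-sym 1↔⊤
  Forest↔Fin (suc m) = Fin-linear↔ 2 (Tree↔Fin m) (Forest↔Fin m)

#tree≡a×#forest≡Δa : ∀ m → #tree m ≡ a (suc m) × #forest m + a m ≡ a (suc m)
#tree≡a×#forest≡Δa zero = refl , refl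
#tree≡a×#forest≡Δa (suc m) with #tree≡a×#forest≡Δa m
... | t≡a , f+a≡a rewrite t≡a = +-cancelʳ-≡ (a m) _ _ tree-step , +-cancelʳ-≡ (a m) _ _ forest-step
  where
    open ≡-Reasoning
    thrice+once : ∀ x → 3 * x + x ≡ 4 * x
    thrice+once = solve-∀
    regroup : ∀ x y z → 2 * x + y + x + z ≡ 3 * x + (y + z)
    regroup = solve-∀
    a₁ = a (suc m)
    f = #forest m
    tree-step : 3 * a₁ + f + a m ≡ a (suc (suc m)) + a m
    tree-step = begin
      3 * a₁ + f + a m   ≡⟨ +-assoc (3 * a₁) f (a m) ⟩
      3 * a₁ + (f + a m) ≡⟨ cong (3 * a₁ +_) f+a≡a ⟩
      3 * a₁ + a₁        ≡⟨ thrice+once a₁ ⟩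
      4 * a₁             ≡⟨ sym (a-recurrence m) ⟩
      a (suc (suc m)) + a m ∎
    forest-step : 2 * a₁ + f + a₁ + a m ≡ a (suc (suc m)) + a m
    forest-step = begin
      2 * a₁ + f + a₁ + a m   ≡⟨ regroup a₁ f (a m) ⟩
      3 * a₁ + (f + a m)      ≡⟨ cong (3 * a₁ +_) f+a≡a ⟩
      3 * a₁ + a₁             ≡⟨ thrice+once a₁ ⟩
      4 * a₁                  ≡⟨ sym (a-recurrence m) ⟩
      a (suc (suc m)) + a m ∎

Tree↔Fin-a : ∀ m → Tree m ↔ Fin (a (suc m))
Tree↔Fin-a m = ↔-trans (Tree↔Fin m) (≡⇒Fin↔ (proj₁ (#tree≡a×#forest≡Δa m)))

module _ {A C : Set} {P : A → Set} where

  mk↔Σ-setoid : (encode : A → C) (decode : C → Σ A P) →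
    (∀ c → encode (proj₁ (decode c)) ≡ c) →
    (∀ {x} → P x → proj₁ (decode (encode x)) ≡ x) →
    Inverse (Σ-setoid A P) (setoid C)
  mk↔Σ-setoid encode decode encode-decode decode-encode = record
    { to = λ x → encode (proj₁ x)
    ; from = decode
    ; to-cong = cong encode
    ; from-cong = λ c≡c′ → cong (λ c → proj₁ (decode c)) c≡c′
    ; inverse = (λ { refl → encode-decode _ }) , λ { {x , px} refl → decode-encode px }
    }

HeadNot1 : ∀ {m} → Vec (Fin 4) m → Set
HeadNot1 [] = ⊤
HeadNot1 (x ∷ _) = ¬ x ≡ suc zero

mutual
  treeWord : ∀ {m} → Tree m → Vec (Fin 4) m
  treeWord {zero} _ = []
  treeWord {suc m} (inj₁ (i , t)) = suc i ∷ treeWord t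
  treeWord {suc m} (inj₂ f) = zero ∷ forestWord f

  forestWord : ∀ {m} → Forest m → Vec (Fin 4) m
  forestWord {zero} _ = []
  forestWord {suc m} (inj₁ (i , t)) = suc (suc i) ∷ treeWord t
  forestWord {suc m} (inj₂ f) = zero ∷ forestWord f

mutual
  wordTree : ∀ {m} → Vec (Fin 4) m → Tree m
  wordTree [] = tt
  wordTree (zero ∷ w) = inj₂ (wordForest w)
  wordTree (suc i ∷ w) = inj₁ (i , wordTree w)

  -- on words starting with 1 the result is junk
  wordForest : ∀ {m} → Vec (Fin 4) m → Forest m
  wordForest [] = tt
  wordForest (zero ∷ w) = inj₂ (wordForest w)
  wordForest (suc zero ∷ w) = inj₂ (wordForest w)
  wordForest (suc (suc i) ∷ w) = inj₁ (i , wordTree w)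

mutual
  wordTree-treeWord : ∀ {m} (t : Tree m) → wordTree (treeWord t) ≡ t
  wordTree-treeWord {zero} t = refl
  wordTree-treeWord {suc m} (inj₁ (i , t)) = cong (λ t → inj₁ (i , t)) (wordTree-treeWord t)
  wordTree-treeWord {suc m} (inj₂ f) = cong inj₂ (wordForest-forestWord f)

  wordForest-forestWord : ∀ {m} (f : Forest m) → wordForest (forestWord f) ≡ f
  wordForest-forestWord {zero} f = refl
  wordForest-forestWord {suc m} (inj₁ (i , t)) = cong (λ t → inj₁ (i , t)) (wordTree-treeWord t)
  wordForest-forestWord {suc m} (inj₂ f) = cong inj₂ (wordForest-forestWord f)

No01-∷ : ∀ {m} x (w : Vec (Fin 4) m) → (x ≡ zero → HeadNot1 w) → No01 w → No01 (x ∷ w)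
No01-∷ x [] _ _ = [-]
No01-∷ x (y ∷ w) x≡0⇒y≢1 w-ok = (λ { (x≡0 , y≡1) → x≡0⇒y≢1 x≡0 y≡1 }) ∷ w-ok

No01-0∷⇒HeadNot1 : ∀ {m} (w : Vec (Fin 4) m) → No01 (zero ∷ w) → HeadNot1 w
No01-0∷⇒HeadNot1 [] _ = tt
No01-0∷⇒HeadNot1 (y ∷ w) (¬01 ∷ _) y≡1 = ¬01 (refl , y≡1)

forestWord-headNot1 : ∀ {m} (f : Forest m) → HeadNot1 (forestWord f)
forestWord-headNot1 {zero} f = tt
forestWord-headNot1 {suc m} (inj₁ _) ()
forestWord-headNot1 {suc m} (inj₂ _) ()

mutual
  treeWord-no01 : ∀ {m} (t : Tree m) → No01 (treeWord t)
  treeWord-no01 {zero} t = []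
  treeWord-no01 {suc m} (inj₁ (i , t)) = No01-∷ _ _ (λ ()) (treeWord-no01 t)
  treeWord-no01 {suc m} (inj₂ f) = No01-∷ _ _ (λ _ → forestWord-headNot1 f) (forestWord-no01 f)

  forestWord-no01 : ∀ {m} (f : Forest m) → No01 (forestWord f)
  forestWord-no01 {zero} f = []
  forestWord-no01 {suc m} (inj₁ (i , t)) = No01-∷ _ _ (λ ()) (treeWord-no01 t)
  forestWord-no01 {suc m} (inj₂ f) = No01-∷ _ _ (λ _ → forestWord-headNot1 f) (forestWord-no01 f)

mutual
  treeWord-wordTree : ∀ {m} (w : Vec (Fin 4) m) → No01 w → treeWord (wordTree w) ≡ w
  treeWord-wordTree [] _ = refl
  treeWord-wordTree (zero ∷ w) ok =
    cong (zero ∷_) (forestWord-wordForest w (Linked.tail ok) (No01-0∷⇒HeadNot1 w ok))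
  treeWord-wordTree (suc i ∷ w) ok = cong (suc i ∷_) (treeWord-wordTree w (Linked.tail ok))

  forestWord-wordForest : ∀ {m} (w : Vec (Fin 4) m) → No01 w → HeadNot1 w → forestWord (wordForest w) ≡ w
  forestWord-wordForest [] _ _ = refl
  forestWord-wordForest (zero ∷ w) ok _ =
    cong (zero ∷_) (forestWord-wordForest w (Linked.tail ok) (No01-0∷⇒HeadNot1 w ok))
  forestWord-wordForest (suc zero ∷ w) _ head≢1 = ⊥-elim (head≢1 refl)
  forestWord-wordForest (suc (suc i) ∷ w) ok _ = cong (suc (suc i) ∷_) (treeWord-wordTree w (Linked.tail ok))

Words01↔Tree : ∀ m → Inverse (Words01 m) (setoid (Tree m))
Words01↔Tree m =
  mk↔Σ-setoid wordTree (λ t → treeWord t , treeWord-no01 t) wordTree-treeWord (treeWord-wordTree _)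

mutual
  EvenColour : ℕ → Set
  EvenColour zero = ⊤
  EvenColour (suc k) = (Fin 2 × EvenColour k) ⊎ OddColour k

  OddColour : ℕ → Set
  OddColour zero = ⊤
  OddColour (suc k) = EvenColour k ⊎ OddColour k

fib-odd : ∀ k → fib (suc (2 * suc k)) ≡ fib (2 * suc k) + fib (suc (2 * k))
fib-odd k = unfold (*-suc 2 k)
  where
    unfold : ∀ {n j} → n ≡ suc (suc j) → fib (suc n) ≡ fib n + fib (suc j)
    unfold refl = refl

fib-even : ∀ k → fib (2 * suc (suc k)) ≡ 2 * fib (2 * suc k) + fib (suc (2 * k))
fib-even k = trans (cong fib (*-suc 2 (suc k)))
  (trans (cong (_+ fib (2 * suc k)) (fib-odd k)) (regroup (fib (2 * suc k)) (fib (suc (2 * k)))))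
  where
    regroup : ∀ x y → x + y + x ≡ 2 * x + y
    regroup = solve-∀

mutual
  EvenColour↔Fin : ∀ k → EvenColour k ↔ Fin (fib (2 * suc k))
  EvenColour↔Fin zero = ↔-sym 1↔⊤
  EvenColour↔Fin (suc k) =
    ↔-trans (Fin-linear↔ 2 (EvenColour↔Fin k) (OddColour↔Fin k)) (≡⇒Fin↔ (sym (fib-even k)))

  OddColour↔Fin : ∀ k → OddColour k ↔ Fin (fib (suc (2 * k)))
  OddColour↔Fin zero = ↔-sym 1↔⊤
  OddColour↔Fin (suc k) = ↔-trans (EvenColour↔Fin k ⊎-↔ OddColour↔Fin k)
    (↔-trans (↔-sym +↔⊎) (≡⇒Fin↔ (sym (fib-odd k))))

-- (k , c) is a part of size k + 1 with colour c.
Part OddPart : Set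
Part = Σ ℕ EvenColour
OddPart = Σ ℕ OddColour

total : List Part → ℕ
total [] = 0
total ((k , _) ∷ ps) = suc k + total ps

grow : ∀ {X Y : ℕ → Set} → (∀ {k} → X k → Y (suc k)) → Σ ℕ X × List Part → Σ ℕ Y × List Part
grow g ((k , c) , ps) = (suc k , g c) , ps

-- A Tree m (resp. Forest m) reads as a composition of m + 1 whose first part
-- carries an EvenColour (resp. OddColour); each step either starts a new part
-- or grows the first one.
mutual
  treeComp : ∀ {m} → Tree m → Part × List Part
  treeComp {zero} _ = (0 , tt) , []
  treeComp {suc m} (inj₁ (zero , t)) = (0 , tt) , uncurry _∷_ (treeComp t)
  treeComp {suc m} (inj₁ (suc i , t)) = grow (λ c → inj₁ (i , c)) (treeComp t)
  treeComp {suc m} (inj₂ f) = grow inj₂ (forestComp f)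

  forestComp : ∀ {m} → Forest m → OddPart × List Part
  forestComp {zero} _ = (0 , tt) , []
  forestComp {suc m} (inj₁ (zero , t)) = (0 , tt) , uncurry _∷_ (treeComp t)
  forestComp {suc m} (inj₁ (suc zero , t)) = grow inj₁ (treeComp t)
  forestComp {suc m} (inj₂ f) = grow inj₂ (forestComp f)

mutual
  compTree : ∀ m → Part → List Part → Tree m
  compTree zero _ _ = tt
  compTree (suc m) (zero , _) [] = junkTree (suc m)
  compTree (suc m) (zero , _) (p ∷ ps) = inj₁ (zero , compTree m p ps)
  compTree (suc m) (suc k , inj₁ (i , c)) ps = inj₁ (suc i , compTree m (k , c) ps)
  compTree (suc m) (suc k , inj₂ c) ps = inj₂ (compForest m (k , c) ps)

  compForest : ∀ m → OddPart → List Part → Forest m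
  compForest zero _ _ = tt
  compForest (suc m) (zero , _) [] = junkForest (suc m)
  compForest (suc m) (zero , _) (p ∷ ps) = inj₁ (zero , compTree m p ps)
  compForest (suc m) (suc k , inj₁ c) ps = inj₁ (suc zero , compTree m (k , c) ps)
  compForest (suc m) (suc k , inj₂ c) ps = inj₂ (compForest m (k , c) ps)

mutual
  compTree-treeComp : ∀ m (t : Tree m) → uncurry (compTree m) (treeComp t) ≡ t
  compTree-treeComp zero t = refl
  compTree-treeComp (suc m) (inj₁ (zero , t)) = cong (λ t → inj₁ (zero , t)) (compTree-treeComp m t)
  compTree-treeComp (suc m) (inj₁ (suc i , t)) = cong (λ t → inj₁ (suc i , t)) (compTree-treeComp m t)
  compTree-treeComp (suc m) (inj₂ f) = cong inj₂ (compForest-forestComp m f)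

  compForest-forestComp : ∀ m (f : Forest m) → uncurry (compForest m) (forestComp f) ≡ f
  compForest-forestComp zero f = refl
  compForest-forestComp (suc m) (inj₁ (zero , t)) = cong (λ t → inj₁ (zero , t)) (compTree-treeComp m t)
  compForest-forestComp (suc m) (inj₁ (suc zero , t)) = cong (λ t → inj₁ (suc zero , t)) (compTree-treeComp m t)
  compForest-forestComp (suc m) (inj₂ f) = cong inj₂ (compForest-forestComp m f)

mutual
  treeComp-total : ∀ m (t : Tree m) → total (uncurry _∷_ (treeComp t)) ≡ suc m
  treeComp-total zero t = refl
  treeComp-total (suc m) (inj₁ (zero , t)) = cong suc (treeComp-total m t)
  treeComp-total (suc m) (inj₁ (suc i , t)) = cong suc (treeComp-total m t)
  treeComp-total (suc m) (inj₂ f) = cong suc (forestComp-total m f)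

  forestComp-total : ∀ m (f : Forest m) →
    suc (proj₁ (proj₁ (forestComp f))) + total (proj₂ (forestComp f)) ≡ suc m
  forestComp-total zero f = refl
  forestComp-total (suc m) (inj₁ (zero , t)) = cong suc (treeComp-total m t)
  forestComp-total (suc m) (inj₁ (suc zero , t)) = cong suc (treeComp-total m t)
  forestComp-total (suc m) (inj₂ f) = cong suc (forestComp-total m f)

mutual
  treeComp-compTree : ∀ m p ps → total (p ∷ ps) ≡ suc m → treeComp (compTree m p ps) ≡ (p , ps)
  treeComp-compTree zero (zero , _) [] _ = refl
  treeComp-compTree zero (zero , _) (_ ∷ _) ()
  treeComp-compTree zero (suc k , _) ps ()
  treeComp-compTree (suc m) (zero , _) [] ()
  treeComp-compTree (suc m) (zero , _) (p ∷ ps) eq =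
    cong (λ x → (zero , tt) , uncurry _∷_ x) (treeComp-compTree m p ps (suc-injective eq))
  treeComp-compTree (suc m) (suc k , inj₁ (i , c)) ps eq =
    cong (grow (λ c → inj₁ (i , c))) (treeComp-compTree m (k , c) ps (suc-injective eq))
  treeComp-compTree (suc m) (suc k , inj₂ c) ps eq =
    cong (grow inj₂) (forestComp-compForest m (k , c) ps (suc-injective eq))

  forestComp-compForest : ∀ m p ps → suc (proj₁ p) + total ps ≡ suc m →
    forestComp (compForest m p ps) ≡ (p , ps)
  forestComp-compForest zero (zero , _) [] _ = refl
  forestComp-compForest zero (zero , _) (_ ∷ _) ()
  forestComp-compForest zero (suc k , _) ps ()
  forestComp-compForest (suc m) (zero , _) [] ()
  forestComp-compForest (suc m) (zero , _) (p ∷ ps) eq =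
    cong (λ x → (zero , tt) , uncurry _∷_ x) (treeComp-compTree m p ps (suc-injective eq))
  forestComp-compForest (suc m) (suc k , inj₁ c) ps eq =
    cong (grow inj₁) (treeComp-compTree m (k , c) ps (suc-injective eq))
  forestComp-compForest (suc m) (suc k , inj₂ c) ps eq =
    cong (grow inj₂) (forestComp-compForest m (k , c) ps (suc-injective eq))

compTreeList : ∀ m → List Part → Tree m
compTreeList m [] = junkTree m
compTreeList m (p ∷ ps) = compTree m p ps

treeComp-compTreeList : ∀ m ps → total ps ≡ suc m → uncurry _∷_ (treeComp (compTreeList m ps)) ≡ ps
treeComp-compTreeList m [] eq = ⊥-elim (0≢1+n eq)
treeComp-compTreeList m (p ∷ ps) eq = cong (uncurry _∷_) (treeComp-compTree m p ps eq)

toColoured : Part → ColoredPart F2k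
toColoured (k , c) = suc k , Inverse.to (EvenColour↔Fin k) c

fromColoured : ColoredPart F2k → Part
fromColoured (zero , ())
fromColoured (suc k , c) = k , Inverse.from (EvenColour↔Fin k) c

fromColoured-toColoured : ∀ p → fromColoured (toColoured p) ≡ p
fromColoured-toColoured (k , c) = cong (k ,_) (Inverse.strictlyInverseʳ (EvenColour↔Fin k) c)

toColoured-fromColoured : ∀ p → toColoured (fromColoured p) ≡ p
toColoured-fromColoured (zero , ())
toColoured-fromColoured (suc k , c) = cong (suc k ,_) (Inverse.strictlyInverseˡ (EvenColour↔Fin k) c)

toColoured-total : ∀ ps → sum (map proj₁ (map toColoured ps)) ≡ total ps
toColoured-total [] = refl
toColoured-total ((k , _) ∷ ps) = cong (suc k +_) (toColoured-total ps)

toColoured-positive : ∀ ps → All (λ p → 1 ≤ proj₁ p) (map toColoured ps)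
toColoured-positive [] = []
toColoured-positive (_ ∷ ps) = s≤s z≤n ∷ toColoured-positive ps

map-toColoured-fromColoured : ∀ ps → map toColoured (map fromColoured ps) ≡ ps
map-toColoured-fromColoured ps = trans (sym (map-∘ ps)) (trans (map-cong toColoured-fromColoured ps) (map-id ps))

map-fromColoured-toColoured : ∀ ps → map fromColoured (map toColoured ps) ≡ ps
map-fromColoured-toColoured ps = trans (sym (map-∘ ps)) (trans (map-cong fromColoured-toColoured ps) (map-id ps))

ColoredComps↔Tree : ∀ m → Inverse (ColoredComps F2k (suc m)) (setoid (Tree m))
ColoredComps↔Tree m = mk↔Σ-setoid encode decode encode-decode decode-encode
  where
    encode : List (ColoredPart F2k) → Tree m
    encode ps = compTreeList m (map fromColoured ps)
    decode : Tree m → Σ (List (ColoredPart F2k)) (IsColoredComp F2k (suc m))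
    decode t = map toColoured ps , toColoured-positive ps , trans (toColoured-total ps) (treeComp-total m t)
      where ps = uncurry _∷_ (treeComp t)
    encode-decode : ∀ t → encode (proj₁ (decode t)) ≡ t
    encode-decode t = trans
      (cong (compTreeList m) (map-fromColoured-toColoured (uncurry _∷_ (treeComp t))))
      (compTree-treeComp m t)
    decode-encode : ∀ {ps} → IsColoredComp F2k (suc m) ps → proj₁ (decode (encode ps)) ≡ ps
    decode-encode {ps} (_ , sum≡) = trans
      (cong (map toColoured) (treeComp-compTreeList m qs total≡))
      (map-toColoured-fromColoured ps)
      where
        qs = map fromColoured ps
        total≡ : total qs ≡ suc m
        total≡ = trans (sym (toColoured-total qs))
          (trans (cong (λ l → sum (map proj₁ l)) (map-toColoured-fromColoured ps)) sum≡)

module _ {A : Set} where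

  lastOf : A → List A → A
  lastOf x [] = x
  lastOf x (y ∷ ys) = lastOf y ys

  lastOf-∈ : ∀ x ys → lastOf x ys ∈ x ∷ ys
  lastOf-∈ x [] = here refl
  lastOf-∈ x (y ∷ ys) = there (lastOf-∈ y ys)

  lastOf-split : ∀ {x ys} ps {u qs} → x ∷ ys ≡ ps ++ u ∷ qs → lastOf x ys ≡ lastOf u qs
  lastOf-split [] refl = refl
  lastOf-split (p ∷ []) refl = refl
  lastOf-split (p ∷ p′ ∷ ps) refl = lastOf-split (p′ ∷ ps) refl

  length-∷ʳ : ∀ (xs : List A) x → length (xs ∷ʳ x) ≡ suc (length xs)
  length-∷ʳ [] x = refl
  length-∷ʳ (y ∷ xs) x = cong suc (length-∷ʳ xs x)

  Unique-++⁻ʳ : ∀ xs {ys : List A} → Unique (xs ++ ys) → Unique ys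
  Unique-++⁻ʳ [] u = u
  Unique-++⁻ʳ (x ∷ xs) (_ ∷ u) = Unique-++⁻ʳ xs u

  Unique-rotate : ∀ {x : A} xs → Unique (x ∷ xs) → Unique (xs ∷ʳ x)
  Unique-rotate [] _ = [] ∷ []
  Unique-rotate (y ∷ xs) ((x≢y ∷ x∉xs) ∷ (y∉xs ∷ u)) =
    All.++⁺ y∉xs ((λ y≡x → x≢y (sym y≡x)) ∷ []) ∷ Unique-rotate xs (x∉xs ∷ u)

  module _ {R : A → A → Set} where

    Linked-∷ʳ : ∀ x ys {z} → Linked R (x ∷ ys) → R (lastOf x ys) z → Linked R ((x ∷ ys) ∷ʳ z)
    Linked-∷ʳ x [] _ r = r ∷ [-]
    Linked-∷ʳ x (y ∷ ys) (r′ ∷ l) r = r′ ∷ Linked-∷ʳ y ys l r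

    Linked-lastOf : ∀ x ys {z} → Linked R ((x ∷ ys) ∷ʳ z) → R (lastOf x ys) z
    Linked-lastOf x [] (r ∷ [-]) = r
    Linked-lastOf x (y ∷ ys) (_ ∷ l) = Linked-lastOf y ys l

    Linked-++⁻ˡ : ∀ xs {ys} → Linked R (xs ++ ys) → Linked R xs
    Linked-++⁻ˡ [] _ = []
    Linked-++⁻ˡ (x ∷ []) _ = [-]
    Linked-++⁻ˡ (x ∷ y ∷ xs) (r ∷ l) = r ∷ Linked-++⁻ˡ (y ∷ xs) l

    Linked-++⁻ʳ : ∀ xs {ys} → Linked R (xs ++ ys) → Linked R ys
    Linked-++⁻ʳ [] l = l
    Linked-++⁻ʳ (x ∷ xs) l = Linked-++⁻ʳ xs (Linked.tail l)

    Linked-∷ʳ-last : ∀ xs {y z} → Linked R (xs ∷ʳ y) → R y z → Linked R (xs ∷ʳ y ∷ʳ z)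
    Linked-∷ʳ-last [] _ r = r ∷ [-]
    Linked-∷ʳ-last (x ∷ []) (r′ ∷ [-]) r = r′ ∷ r ∷ [-]
    Linked-∷ʳ-last (x ∷ x′ ∷ xs) (r′ ∷ l) r = r′ ∷ Linked-∷ʳ-last (x′ ∷ xs) l r

lastOf-map : ∀ {A B : Set} (f : A → B) x ys → lastOf (f x) (map f ys) ≡ f (lastOf x ys)
lastOf-map f x [] = refl
lastOf-map f x (y ∷ ys) = lastOf-map f y ys

_≟ᵥ_ : ∀ {m} → DecidableEquality (Vertex m)
_≟ᵥ_ = ≡-dec Fin._≟_ Fin._≟_

Adj-sym : ∀ {m} {S : EdgeSet m} {u v} → Adj S u v → Adj S v u
Adj-sym (e , e∈S , inj₁ ends≡) = e , e∈S , inj₂ ends≡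
Adj-sym (e , e∈S , inj₂ ends≡) = e , e∈S , inj₁ ends≡

IsCycle : ∀ {m} → EdgeSet m → Vertex m → List (Vertex m) → Set
IsCycle S x xs = 2 ≤ length xs × Unique (x ∷ xs) × Linked (Adj S) ((x ∷ xs) ∷ʳ x)

IsCycleList : ∀ {m} → EdgeSet m → List (Vertex m) → Set
IsCycleList S [] = ⊥
IsCycleList S (x ∷ xs) = IsCycle S x xs

module _ {m : ℕ} {S : EdgeSet m} where
  open Membershipᵈ (_≟ᵥ_ {m}) using (_∈?_)

  walk-++ : ∀ {u v w} → Walk S u v → Walk S v w → Walk S u w
  walk-++ here q = q
  walk-++ (step a p) q = step a (walk-++ p q)

  walk-reverse : ∀ {u v} → Walk S u v → Walk S v u
  walk-reverse here = here
  walk-reverse (step a p) = walk-++ (walk-reverse p) (step (Adj-sym a) here)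

  edge-walk : ∀ {u v} → Adj S u v → Walk S u v
  edge-walk a = step a here

  walk-preserves : ∀ {B : Set} (f : Vertex m → B) → (∀ {u v} → Adj S u v → f u ≡ f v) →
    ∀ {u v} → Walk S u v → f u ≡ f v
  walk-preserves f f-adj here = refl
  walk-preserves f f-adj (step a w) = trans (f-adj a) (walk-preserves f f-adj w)

  simplePath : ∀ {u v} → Walk S u v →
    Σ (List (Vertex m)) λ ys → Unique (u ∷ ys) × Linked (Adj S) (u ∷ ys) × lastOf u ys ≡ v
  simplePath here = [] , ([] ∷ []) , [-] , refl
  simplePath {u} (step {v = w} a rest) with simplePath rest
  ... | ys , uniq , linked , last≡ with u ∈? (w ∷ ys)
  ...   | no u∉ = w ∷ ys , (All.¬Any⇒All¬ (w ∷ ys) u∉ ∷ uniq) , a ∷ linked , last≡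
  ...   | yes u∈ with ∈-∃++ u∈
  ...     | ps , qs , split =
    qs , Unique-++⁻ʳ ps (subst Unique split uniq) , Linked-++⁻ʳ ps (subst (Linked (Adj S)) split linked) ,
    trans (sym (lastOf-split ps split)) last≡

  IsCycle-rotate : ∀ {x y} zs → IsCycle S x (y ∷ zs) → IsCycle S y (zs ∷ʳ x)
  IsCycle-rotate [] (s≤s () , _)
  IsCycle-rotate {x} (z ∷ zs) (_ , uniq , (x~y ∷ linked)) =
    subst (2 ≤_) (sym (cong suc (length-∷ʳ zs x))) (s≤s (s≤s z≤n)) ,
    Unique-rotate {x = x} (_ ∷ z ∷ zs) uniq , Linked-∷ʳ-last (_ ∷ z ∷ zs) linked x~y

  IsCycle-rotateTo : ∀ ps c qs → IsCycleList S (ps ++ c ∷ qs) → Σ (List (Vertex m)) (IsCycle S c)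
  IsCycle-rotateTo [] c qs cyc = qs , cyc
  IsCycle-rotateTo (p ∷ []) c qs cyc = qs ∷ʳ p , IsCycle-rotate qs cyc
  IsCycle-rotateTo (p ∷ p′ ∷ ps) c qs cyc = IsCycle-rotateTo (p′ ∷ ps) c (qs ∷ʳ p)
    (subst (IsCycle S p′) (++-assoc ps (c ∷ qs) (p ∷ [])) (IsCycle-rotate (ps ++ c ∷ qs) cyc))

  IsCycle-through : ∀ {x xs c} → IsCycle S x xs → c ∈ x ∷ xs → Σ (List (Vertex m)) (IsCycle S c)
  IsCycle-through cyc c∈ with ∈-∃++ c∈
  ... | ps , qs , split = IsCycle-rotateTo ps _ qs (subst (IsCycleList S) split cyc)

  IsCycle-delete : ∀ {c} ys → IsCycle S c ys →
    Σ (Vertex m) λ y → Σ (List (Vertex m)) λ ws → ys ≡ y ∷ ws × Adj S c y × Adj S c (lastOf y ws) ×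
      ¬ y ≡ lastOf y ws × Linked (Adj S) (y ∷ ws) × All (λ v → ¬ c ≡ v) (y ∷ ws)
  IsCycle-delete [] (() , _)
  IsCycle-delete (y ∷ []) (s≤s () , _)
  IsCycle-delete (y ∷ w ∷ ws) (_ , (c∉ ∷ (y∉ ∷ _)) , (c~y ∷ linked)) =
    y , w ∷ ws , refl , c~y , Adj-sym (Linked-lastOf y (w ∷ ws) linked) ,
    All.lookup y∉ (lastOf-∈ w ws) , Linked-++⁻ˡ (y ∷ w ∷ ws) linked , c∉

  IsCycle-∈-neighbours : ∀ {c} ys → IsCycle S c ys →
    Σ (Vertex m) λ y → Σ (Vertex m) λ z → Adj S c y × Adj S c z × ¬ y ≡ z × y ∈ ys × z ∈ ys
  IsCycle-∈-neighbours ys cyc with IsCycle-delete ys cyc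
  ... | y , ws , refl , c~y , c~z , y≢z , _ = y , lastOf y ws , c~y , c~z , y≢z , here refl , lastOf-∈ y ws

  path-preserves : ∀ {B : Set} (f : Vertex m → B) (P : Vertex m → Set) →
    (∀ {u v} → P u → P v → Adj S u v → f u ≡ f v) →
    ∀ y ws → Linked (Adj S) (y ∷ ws) → All P (y ∷ ws) → f y ≡ f (lastOf y ws)
  path-preserves f P f-adj y [] _ _ = refl
  path-preserves f P f-adj y (w ∷ ws) (y~w ∷ linked) (py ∷ pws) =
    trans (f-adj py (All.head pws) y~w) (path-preserves f P f-adj w ws linked pws)

-- The new column becomes column 0 and the old columns move up by one; t and b
-- are the top and bottom rails joining it to the old column 0, r is its rung.
addColumn : ∀ {m} → Bool → Bool → Bool → EdgeSet m → EdgeSet (suc m)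
addColumn t b r S = edgeSet (r ∷ rungs S) (t ∷ rails0 S) (b ∷ rails1 S)

shift : ∀ {m} → Vertex m → Vertex (suc m)
shift (i , β) = suc i , β

shift-injective : ∀ {m} {u v : Vertex m} → shift u ≡ shift v → u ≡ v
shift-injective {u = i , β} {j , γ} refl = refl

newRail : Bool → Bool → Fin 2 → Bool
newRail t b zero = t
newRail t b (suc zero) = b

opposite : Fin 2 → Fin 2
opposite zero = suc zero
opposite (suc zero) = zero

CutOff : ∀ {m} → EdgeSet m → Vertex m → Set
CutOff S v = ∀ γ → ¬ Walk S v (zero , γ)

module _ {m : ℕ} {t b r : Bool} {S : EdgeSet m} where
  private
    G = addColumn t b r S

  shiftEdge : Edge m → Edge (suc m)
  shiftEdge (rung i) = rung (suc i)
  shiftEdge (rail β i) = rail β (suc i)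

  shiftEdge-∈ : ∀ e → e ∈E S → shiftEdge e ∈E G
  shiftEdge-∈ (rung i) e∈S = e∈S
  shiftEdge-∈ (rail zero i) e∈S = e∈S
  shiftEdge-∈ (rail (suc zero) i) e∈S = e∈S

  shiftEdge-ends : ∀ e {u v} → ends e ≡ (u , v) → ends (shiftEdge e) ≡ (shift u , shift v)
  shiftEdge-ends (rung i) refl = refl
  shiftEdge-ends (rail β i) refl = refl

  shiftAdj : ∀ {u v} → Adj S u v → Adj G (shift u) (shift v)
  shiftAdj (e , e∈S , ends≡) =
    shiftEdge e , shiftEdge-∈ e e∈S , Sum.map (shiftEdge-ends e) (shiftEdge-ends e) ends≡

  shiftWalk : ∀ {u v} → Walk S u v → Walk G (shift u) (shift v)
  shiftWalk here = here
  shiftWalk (step a w) = step (shiftAdj a) (shiftWalk w)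

  unshiftEdge : ∀ {i β j γ} (e : Edge (suc m)) → e ∈E G → ends e ≡ ((suc i , β) , (suc j , γ)) →
    Σ (Edge m) λ e′ → e′ ∈E S × ends e′ ≡ ((i , β) , (j , γ))
  unshiftEdge (rung zero) _ ()
  unshiftEdge (rung (suc k)) e∈G refl = rung k , e∈G , refl
  unshiftEdge (rail zero zero) _ ()
  unshiftEdge (rail (suc zero) zero) _ ()
  unshiftEdge (rail zero (suc k)) e∈G refl = rail zero k , e∈G , refl
  unshiftEdge (rail (suc zero) (suc k)) e∈G refl = rail (suc zero) k , e∈G , refl

  unshiftAdj : ∀ {u v} → Adj G (shift u) (shift v) → Adj S u v
  unshiftAdj {i , β} {j , γ} (e , e∈G , inj₁ ends≡) with unshiftEdge e e∈G ends≡
  ... | e′ , e′∈S , ends′≡ = e′ , e′∈S , inj₁ ends′≡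
  unshiftAdj {i , β} {j , γ} (e , e∈G , inj₂ ends≡) with unshiftEdge e e∈G ends≡
  ... | e′ , e′∈S , ends′≡ = e′ , e′∈S , inj₂ ends′≡

  newColumn-adj : ∀ {β y} → Adj G (zero , β) y →
    (y ≡ (zero , opposite β) × r ≡ true) ⊎ (y ≡ (suc zero , β) × newRail t b β ≡ true)
  newColumn-adj (rung zero , e∈G , inj₁ refl) = inj₁ (refl , e∈G)
  newColumn-adj (rung zero , e∈G , inj₂ refl) = inj₁ (refl , e∈G)
  newColumn-adj (rung (suc k) , _ , inj₁ ())
  newColumn-adj (rung (suc k) , _ , inj₂ ())
  newColumn-adj (rail zero zero , e∈G , inj₁ refl) = inj₂ (refl , e∈G)
  newColumn-adj (rail (suc zero) zero , e∈G , inj₁ refl) = inj₂ (refl , e∈G)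
  newColumn-adj (rail zero zero , _ , inj₂ ())
  newColumn-adj (rail (suc zero) zero , _ , inj₂ ())
  newColumn-adj (rail zero (suc k) , _ , inj₁ ())
  newColumn-adj (rail (suc zero) (suc k) , _ , inj₁ ())
  newColumn-adj (rail zero (suc k) , _ , inj₂ ())
  newColumn-adj (rail (suc zero) (suc k) , _ , inj₂ ())

  oldColumn-adj : ∀ {i β y} → Adj G (suc i , β) y →
    (y ≡ (zero , β) × i ≡ zero × newRail t b β ≡ true) ⊎
    Σ (Fin (suc m)) λ j → Σ (Fin 2) λ γ → y ≡ (suc j , γ) × Adj S (i , β) (j , γ)
  oldColumn-adj {y = zero , γ} a with newColumn-adj (Adj-sym a)
  ... | inj₁ (() , _)
  ... | inj₂ (refl , rail∈G) = inj₁ (refl , refl , rail∈G)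
  oldColumn-adj {y = suc j , γ} a = inj₂ (j , γ , refl , unshiftAdj a)

  topRail : t ≡ true → Adj G (zero , zero) (suc zero , zero)
  topRail t≡true = rail zero zero , t≡true , inj₁ refl

  bottomRail : b ≡ true → Adj G (zero , suc zero) (suc zero , suc zero)
  bottomRail b≡true = rail (suc zero) zero , b≡true , inj₁ refl

  newRung : r ≡ true → Adj G (zero , zero) (zero , suc zero)
  newRung r≡true = rung zero , r≡true , inj₁ refl

  walk-into-newColumn : ∀ {i β γ} → Walk G (suc i , β) (zero , γ) →
    Σ (Fin 2) λ δ → Walk S (i , β) (zero , δ) × newRail t b δ ≡ true
  walk-into-newColumn (step a w) with oldColumn-adj a
  ... | inj₁ (refl , refl , rail∈G) = _ , here , rail∈G
  ... | inj₂ (j , γ , refl , a′) with walk-into-newColumn w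
  ...   | δ , w′ , rail∈G = δ , step a′ w′ , rail∈G

  CutOff-shift : ∀ {v} → CutOff S v → CutOff G (shift v)
  CutOff-shift {i , β} cut γ w with walk-into-newColumn w
  ... | δ , w′ , _ = cut δ w′

Shifted : ∀ {m} → Vertex (suc m) → Set
Shifted {m} v = Σ (Vertex m) λ u → v ≡ shift u

shifted-or-newColumn : ∀ {m} (vs : List (Vertex (suc m))) →
  All Shifted vs ⊎ Σ (Fin 2) λ β → (zero , β) ∈ vs
shifted-or-newColumn [] = inj₁ []
shifted-or-newColumn ((zero , β) ∷ vs) = inj₂ (β , here refl)
shifted-or-newColumn ((suc i , β) ∷ vs) with shifted-or-newColumn vs
... | inj₁ shifted = inj₁ (((i , β) , refl) ∷ shifted)
... | inj₂ (γ , γ∈) = inj₂ (γ , there γ∈)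

All-Shifted⇒map : ∀ {m} {vs : List (Vertex (suc m))} → All Shifted vs →
  Σ (List (Vertex m)) λ us → vs ≡ map shift us
All-Shifted⇒map [] = [] , refl
All-Shifted⇒map ((u , refl) ∷ shifted) with All-Shifted⇒map shifted
... | us , refl = u ∷ us , refl

extendColouring : ∀ {m} → (Fin 2 → Bool) → (Vertex m → Bool) → Vertex (suc m) → Bool
extendColouring new old (zero , β) = new β
extendColouring new old (suc i , β) = old (i , β)

module _ {m : ℕ} {t b r : Bool} {S : EdgeSet m} where
  private
    G = addColumn t b r S

  IsCycle-shift : ∀ {x xs} → IsCycle S x xs → IsCycle G (shift x) (map shift xs)
  IsCycle-shift {x} {xs} (long , uniq , linked) =
    subst (2 ≤_) (sym (length-map shift xs)) long ,
    Unique.map⁺ shift-injective uniq ,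
    subst (Linked (Adj G)) (map-++ shift (x ∷ xs) (x ∷ [])) (Linked.map⁺ (Linked.map shiftAdj linked))

  IsCycle-unshift : ∀ {x xs} → IsCycle G (shift x) (map shift xs) → IsCycle S x xs
  IsCycle-unshift {x} {xs} (long , uniq , linked) =
    subst (2 ≤_) (length-map shift xs) long ,
    Unique.map⁻ uniq ,
    Linked.map unshiftAdj (Linked.map⁻ (subst (Linked (Adj G)) (sym (map-++ shift (x ∷ xs) (x ∷ []))) linked))

  Cycle-shift : Cycle S → Cycle G
  Cycle-shift (x , xs , cyc) = shift x , map shift xs , IsCycle-shift cyc

  -- A new vertex on a cycle has degree 2 there, so both of its new edges lie on it.
  IsCycle-newColumn : ∀ {β ys} → IsCycle G (zero , β) ys →
    r ≡ true × newRail t b β ≡ true × (zero , opposite β) ∈ ys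
  IsCycle-newColumn {β} {ys} cyc with IsCycle-∈-neighbours ys cyc
  ... | y , z , c~y , c~z , y≢z , y∈ , z∈ with newColumn-adj c~y | newColumn-adj c~z
  ... | inj₁ (refl , _) | inj₁ (refl , _) = ⊥-elim (y≢z refl)
  ... | inj₁ (refl , r≡true) | inj₂ (refl , rail≡true) = r≡true , rail≡true , y∈
  ... | inj₂ (refl , rail≡true) | inj₁ (refl , r≡true) = r≡true , rail≡true , z∈
  ... | inj₂ (refl , _) | inj₂ (refl , _) = ⊥-elim (y≢z refl)

  AllNew : Set
  AllNew = t ≡ true × b ≡ true × r ≡ true

  Cycle-addColumn : Cycle G → Cycle S ⊎ (AllNew × Σ (List (Vertex (suc m))) (IsCycle G (zero , zero)))
  Cycle-addColumn (x , xs , cyc) with shifted-or-newColumn (x ∷ xs)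
  ... | inj₁ shifted with All-Shifted⇒map shifted
  ...   | x′ ∷ xs′ , refl = inj₁ (x′ , xs′ , IsCycle-unshift cyc)
  Cycle-addColumn (x , xs , cyc) | inj₂ (β , β∈) with IsCycle-through cyc β∈
  ... | ys , cyc₁ with IsCycle-newColumn cyc₁
  ...   | r≡true , rail₁ , opp∈ with IsCycle-through cyc₁ (there opp∈)
  ...     | ys′ , cyc₂ with IsCycle-newColumn cyc₂
  ...       | _ , rail₂ , _ = inj₂ (both β rail₁ rail₂ cyc₁ cyc₂)
    where
      both : ∀ β → newRail t b β ≡ true → newRail t b (opposite β) ≡ true →
        IsCycle G (zero , β) ys → IsCycle G (zero , opposite β) ys′ →
        AllNew × Σ (List (Vertex (suc m))) (IsCycle G (zero , zero))
      both zero t≡true b≡true cyc₁ _ = (t≡true , b≡true , r≡true) , ys , cyc₁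
      both (suc zero) b≡true t≡true _ cyc₂ = (t≡true , b≡true , r≡true) , ys′ , cyc₂

  addColumn-acyclic : Acyclic S → ¬ AllNew → Acyclic G
  addColumn-acyclic acyclic notAll c with Cycle-addColumn c
  ... | inj₁ c′ = acyclic c′
  ... | inj₂ (allNew , _) = notAll allNew

  extendColouring-adj : (new : Fin 2 → Bool) (old : Vertex m → Bool) →
    (∀ {u v} → Adj S u v → old u ≡ old v) →
    (r ≡ true → new zero ≡ new (suc zero)) →
    (∀ β → newRail t b β ≡ true → new β ≡ old (zero , β)) →
    ∀ {u v} → Adj G u v → extendColouring new old u ≡ extendColouring new old v
  extendColouring-adj new old old-adj rung-ok rail-ok {zero , β} a with newColumn-adj a
  extendColouring-adj new old old-adj rung-ok rail-ok {zero , zero} a | inj₁ (refl , r≡true) = rung-ok r≡true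
  extendColouring-adj new old old-adj rung-ok rail-ok {zero , suc zero} a | inj₁ (refl , r≡true) = sym (rung-ok r≡true)
  ... | inj₂ (refl , rail≡true) = rail-ok β rail≡true
  extendColouring-adj new old old-adj rung-ok rail-ok {suc i , β} a with oldColumn-adj a
  ... | inj₁ (refl , refl , rail≡true) = sym (rail-ok β rail≡true)
  ... | inj₂ (j , γ , refl , a′) = old-adj a′

Rooted : ∀ {m} → EdgeSet m → Set
Rooted S = ∀ v → Walk S v (zero , zero)

Separated : ∀ {m} → EdgeSet m → Set
Separated {m} S = Σ (Vertex m → Bool) λ colour →
  (∀ {u v} → Adj S u v → colour u ≡ colour v) × colour (zero , zero) ≡ false × colour (zero , suc zero) ≡ true

isBottom : Fin 2 → Bool
isBottom zero = false
isBottom (suc zero) = true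

allNew-neighbour : ∀ {m} {S : EdgeSet m} {y} → Adj (addColumn true true true S) (zero , zero) y →
  y ≡ (zero , suc zero) ⊎ y ≡ (suc zero , zero)
allNew-neighbour a = Sum.map proj₁ proj₁ (newColumn-adj a)

module _ {m : ℕ} {S : EdgeSet m} where
  private
    G = addColumn true true true S

  -- Colour the new column by row: this colouring is constant on every edge of G
  -- except the new rung, while the two neighbours of (0,0) get different colours.
  Separated⇒addColumn-acyclic : Acyclic S → Separated S → Acyclic G
  Separated⇒addColumn-acyclic acyclic (col , col-adj , col₀₀ , col₀₁) c with Cycle-addColumn c
  ... | inj₁ c′ = acyclic c′
  ... | inj₂ (_ , ys , cyc) with IsCycle-delete ys cyc
  ...   | y , ws , _ , c~y , c~z , y≢z , path , avoids =
    different-colours (allNew-neighbour c~y) (allNew-neighbour c~z) y≢z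
      (path-preserves colour NotCorner colour-adj y ws path avoids)
    where
      colour = extendColouring isBottom col
      NotCorner : Vertex (suc m) → Set
      NotCorner v = ¬ (zero , zero) ≡ v
      colour-adj : ∀ {u v} → NotCorner u → NotCorner v → Adj G u v → colour u ≡ colour v
      colour-adj {zero , zero} u≢c _ _ = ⊥-elim (u≢c refl)
      colour-adj {zero , suc zero} _ v≢c a with newColumn-adj a
      ... | inj₁ (refl , _) = ⊥-elim (v≢c refl)
      ... | inj₂ (refl , _) = sym col₀₁
      colour-adj {suc i , β} _ v≢c a with oldColumn-adj a
      colour-adj {suc i , zero} _ v≢c a | inj₁ (refl , refl , _) = ⊥-elim (v≢c refl)
      colour-adj {suc i , suc zero} _ v≢c a | inj₁ (refl , refl , _) = col₀₁
      ... | inj₂ (j , γ , refl , a′) = col-adj a′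
      different-colours : ∀ {y z} → y ≡ (zero , suc zero) ⊎ y ≡ (suc zero , zero) →
        z ≡ (zero , suc zero) ⊎ z ≡ (suc zero , zero) → ¬ y ≡ z → ¬ colour y ≡ colour z
      different-colours (inj₁ refl) (inj₁ refl) y≢z _ = y≢z refl
      different-colours (inj₁ refl) (inj₂ refl) _ eq with trans eq col₀₀
      ... | ()
      different-colours (inj₂ refl) (inj₁ refl) _ eq with trans (sym eq) col₀₀
      ... | ()
      different-colours (inj₂ refl) (inj₂ refl) y≢z _ = y≢z refl

  -- The new rung, the two new rails and a simple path from (0,1) to (0,0) in S
  -- close up to a cycle.
  Rooted⇒addColumn-cycle : Rooted S → Cycle G
  Rooted⇒addColumn-cycle rooted with simplePath (rooted (zero , suc zero))
  ... | ys , uniq , linked , last≡ =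
    (zero , suc zero) , (map shift P ∷ʳ (zero , zero)) ,
    subst (2 ≤_) (sym (length-∷ʳ (map shift P) (zero , zero))) (s≤s (s≤s z≤n)) ,
    (All.++⁺ (newColumn∉ (suc zero) P) ((λ ()) ∷ []) ∷
      Unique-rotate (map shift P) (newColumn∉ zero P ∷ Unique.map⁺ shift-injective uniq)) ,
    (bottomRail refl ∷ Linked-∷ʳ-last (map shift P) shifted-path (newRung refl))
    where
      P = (zero , suc zero) ∷ ys
      newColumn∉ : ∀ β (vs : List (Vertex m)) → All (λ v → ¬ (zero , β) ≡ v) (map shift vs)
      newColumn∉ β [] = []
      newColumn∉ β (_ ∷ vs) = (λ ()) ∷ newColumn∉ β vs
      shifted-path : Linked (Adj G) (map shift P ∷ʳ (zero , zero))
      shifted-path = Linked-∷ʳ (shift (zero , suc zero)) (map shift ys) (Linked.map⁺ (Linked.map shiftAdj linked))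
        (subst (λ v → Adj G v (zero , zero)) (sym (trans (lastOf-map shift (zero , suc zero) ys) (cong shift last≡)))
          (Adj-sym (topRail refl)))

-- Extending a spanning tree of L_{m+1} by a column uses exactly two of the three
-- new edges (three ways) or only one rail (two ways, leaving a forest that
-- separates the new rung's ends); a separating forest extends to a tree with all
-- three edges and to a separating forest with both rails only.
data Shape (m : ℕ) : Set where
  tree : Tree m → Shape m
  forest : Forest m → Shape m
  invalid : Shape m

extendShape : ∀ {m} → Shape m → Bool → Bool → Bool → Shape (suc m)
extendShape (tree c) true true false = tree (inj₁ (zero , c))
extendShape (tree c) true false true = tree (inj₁ (suc zero , c))
extendShape (tree c) false true true = tree (inj₁ (suc (suc zero) , c))
extendShape (tree c) true false false = forest (inj₁ (zero , c))
extendShape (tree c) false true false = forest (inj₁ (suc zero , c))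
extendShape (tree c) true true true = invalid
extendShape (tree c) false false r = invalid
extendShape (forest d) true true true = tree (inj₂ d)
extendShape (forest d) true true false = forest (inj₂ d)
extendShape (forest d) false b r = invalid
extendShape (forest d) true false r = invalid
extendShape invalid t b r = invalid

shape : ∀ {m} → EdgeSet m → Shape m
shape {zero} (edgeSet (true ∷ []) [] []) = tree tt
shape {zero} (edgeSet (false ∷ []) [] []) = forest tt
shape {suc m} (edgeSet (r ∷ rs) (t ∷ ts) (b ∷ bs)) = extendShape (shape (edgeSet rs ts bs)) t b r

mutual
  treeEdges : ∀ {m} → Tree m → EdgeSet m
  treeEdges {zero} _ = edgeSet (true ∷ []) [] []
  treeEdges {suc m} (inj₁ (zero , c)) = addColumn true true false (treeEdges c)
  treeEdges {suc m} (inj₁ (suc zero , c)) = addColumn true false true (treeEdges c)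
  treeEdges {suc m} (inj₁ (suc (suc zero) , c)) = addColumn false true true (treeEdges c)
  treeEdges {suc m} (inj₂ d) = addColumn true true true (forestEdges d)

  forestEdges : ∀ {m} → Forest m → EdgeSet m
  forestEdges {zero} _ = edgeSet (false ∷ []) [] []
  forestEdges {suc m} (inj₁ (zero , c)) = addColumn true false false (treeEdges c)
  forestEdges {suc m} (inj₁ (suc zero , c)) = addColumn false true false (treeEdges c)
  forestEdges {suc m} (inj₂ d) = addColumn true true false (forestEdges d)

mutual
  shape-treeEdges : ∀ {m} (c : Tree m) → shape (treeEdges c) ≡ tree c
  shape-treeEdges {zero} c = refl
  shape-treeEdges {suc m} (inj₁ (zero , c)) rewrite shape-treeEdges c = refl
  shape-treeEdges {suc m} (inj₁ (suc zero , c)) rewrite shape-treeEdges c = refl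
  shape-treeEdges {suc m} (inj₁ (suc (suc zero) , c)) rewrite shape-treeEdges c = refl
  shape-treeEdges {suc m} (inj₂ d) rewrite shape-forestEdges d = refl

  shape-forestEdges : ∀ {m} (d : Forest m) → shape (forestEdges d) ≡ forest d
  shape-forestEdges {zero} d = refl
  shape-forestEdges {suc m} (inj₁ (zero , c)) rewrite shape-treeEdges c = refl
  shape-forestEdges {suc m} (inj₁ (suc zero , c)) rewrite shape-treeEdges c = refl
  shape-forestEdges {suc m} (inj₂ d) rewrite shape-forestEdges d = refl

shapeEdges : ∀ {m} → Shape m → EdgeSet m
shapeEdges (tree c) = treeEdges c
shapeEdges (forest d) = forestEdges d
shapeEdges {m} invalid = forestEdges (junkForest m)

shapeEdges-extendShape : ∀ {m} (x : Shape m) t b r → ¬ extendShape x t b r ≡ invalid →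
  shapeEdges (extendShape x t b r) ≡ addColumn t b r (shapeEdges x) × ¬ x ≡ invalid
shapeEdges-extendShape (tree c) true true false _ = refl , λ ()
shapeEdges-extendShape (tree c) true false true _ = refl , λ ()
shapeEdges-extendShape (tree c) false true true _ = refl , λ ()
shapeEdges-extendShape (tree c) true false false _ = refl , λ ()
shapeEdges-extendShape (tree c) false true false _ = refl , λ ()
shapeEdges-extendShape (tree c) true true true valid = ⊥-elim (valid refl)
shapeEdges-extendShape (tree c) false false r valid = ⊥-elim (valid refl)
shapeEdges-extendShape (forest d) true true true _ = refl , λ ()
shapeEdges-extendShape (forest d) true true false _ = refl , λ ()
shapeEdges-extendShape (forest d) false b r valid = ⊥-elim (valid refl)
shapeEdges-extendShape (forest d) true false r valid = ⊥-elim (valid refl)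
shapeEdges-extendShape invalid t b r valid = ⊥-elim (valid refl)

shapeEdges-shape : ∀ {m} (S : EdgeSet m) → ¬ shape S ≡ invalid → shapeEdges (shape S) ≡ S
shapeEdges-shape {zero} (edgeSet (true ∷ []) [] []) _ = refl
shapeEdges-shape {zero} (edgeSet (false ∷ []) [] []) _ = refl
shapeEdges-shape {suc m} (edgeSet (r ∷ rs) (t ∷ ts) (b ∷ bs)) valid
  with shapeEdges-extendShape (shape (edgeSet rs ts bs)) t b r valid
... | extended , valid′ = trans extended (cong (addColumn t b r) (shapeEdges-shape (edgeSet rs ts bs) valid′))

bit : Bool → ℕ
bit true = 1
bit false = 0

trues-∷ : ∀ {k} x (v : Vec Bool k) → trues (x ∷ v) ≡ bit x + trues v
trues-∷ true v = refl
trues-∷ false v = refl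

size-addColumn : ∀ {m} t b r (S : EdgeSet m) {n} → size S ≡ n →
  size (addColumn t b r S) ≡ (bit r + bit t + bit b) + n
size-addColumn t b r S refl
  rewrite trues-∷ r (rungs S) | trues-∷ t (rails0 S) | trues-∷ b (rails1 S) =
  regroup (bit r) (bit t) (bit b) (trues (rungs S)) (trues (rails0 S)) (trues (rails1 S))
  where
    regroup : ∀ x y z u v w → (x + u) + (y + v) + (z + w) ≡ (x + y + z) + (u + v + w)
    regroup = solve-∀

twice-suc : ∀ m → suc (suc (2 * m)) ≡ 2 * suc m
twice-suc m = sym (*-suc 2 m)

TwoRooted : ∀ {m} → EdgeSet m → Set
TwoRooted S = ∀ v → Walk S v (zero , zero) ⊎ Walk S v (zero , suc zero)

RootedTree : ∀ {m} → EdgeSet m → Set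
RootedTree {m} S = size S ≡ suc (2 * m) × Rooted S × Acyclic S

SeparatedForest : ∀ {m} → EdgeSet m → Set
SeparatedForest {m} S = size S ≡ 2 * m × TwoRooted S × Separated S × Acyclic S

Defective : ∀ {m} → EdgeSet m → Set
Defective {m} S = (Σ (Vertex m) (CutOff S)) ⊎ Cycle S

Describes : ∀ {m} → Shape m → EdgeSet m → Set
Describes (tree _) = RootedTree
Describes (forest _) = SeparatedForest
Describes invalid = Defective

Separated-walk : ∀ {m} {S : EdgeSet m} → Separated S → ¬ Walk S (zero , zero) (zero , suc zero)
Separated-walk (colour , colour-adj , colour₀₀ , colour₀₁) w
  with trans (sym colour₀₀) (trans (walk-preserves colour colour-adj w) colour₀₁)
... | ()

Vertex₀-no-three-distinct : (x y z : Vertex 0) → ¬ x ≡ y → ¬ x ≡ z → ¬ y ≡ z → ⊥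
Vertex₀-no-three-distinct (zero , zero) (zero , zero) z x≢y _ _ = x≢y refl
Vertex₀-no-three-distinct (zero , suc zero) (zero , suc zero) z x≢y _ _ = x≢y refl
Vertex₀-no-three-distinct (zero , zero) (zero , suc zero) (zero , zero) _ x≢z _ = x≢z refl
Vertex₀-no-three-distinct (zero , zero) (zero , suc zero) (zero , suc zero) _ _ y≢z = y≢z refl
Vertex₀-no-three-distinct (zero , suc zero) (zero , zero) (zero , zero) _ _ y≢z = y≢z refl
Vertex₀-no-three-distinct (zero , suc zero) (zero , zero) (zero , suc zero) _ x≢z _ = x≢z refl

Vertex₀-acyclic : (S : EdgeSet 0) → Acyclic S
Vertex₀-acyclic S (x , [] , () , _)
Vertex₀-acyclic S (x , y ∷ [] , s≤s () , _)
Vertex₀-acyclic S (x , y ∷ z ∷ _ , _ , ((x≢y ∷ x≢z ∷ _) ∷ (y≢z ∷ _) ∷ _) , _) =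
  Vertex₀-no-three-distinct x y z x≢y x≢z y≢z

no-rung-no-adj : ∀ {u v} → ¬ Adj (edgeSet (false ∷ []) [] []) u v
no-rung-no-adj (rung zero , () , _)
no-rung-no-adj (rail zero () , _)
no-rung-no-adj (rail (suc zero) () , _)

shape-describes₀ : ∀ (S : EdgeSet 0) → Describes (shape S) S
shape-describes₀ S@(edgeSet (true ∷ []) [] []) = refl , rooted , Vertex₀-acyclic S
  where
    rooted : Rooted S
    rooted (zero , zero) = here
    rooted (zero , suc zero) = edge-walk (Adj-sym (rung zero , refl , inj₁ refl))
shape-describes₀ S@(edgeSet (false ∷ []) [] []) =
  refl , twoRooted , ((λ v → isBottom (proj₂ v)) , (λ a → ⊥-elim (no-rung-no-adj a)) , refl , refl) ,
  Vertex₀-acyclic S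
  where
    twoRooted : TwoRooted S
    twoRooted (zero , zero) = inj₁ here
    twoRooted (zero , suc zero) = inj₂ here

module _ {m : ℕ} {S : EdgeSet m} where

  toTop : ∀ {b r} → Walk (addColumn true b r S) (suc zero , zero) (zero , zero)
  toTop = edge-walk (Adj-sym (topRail refl))

  toBottom : ∀ {t r} → Walk (addColumn t true r S) (suc zero , suc zero) (zero , suc zero)
  toBottom = edge-walk (Adj-sym (bottomRail refl))

  acrossRung : ∀ {t b} → Walk (addColumn t b true S) (zero , suc zero) (zero , zero)
  acrossRung = edge-walk (Adj-sym (newRung refl))

  module _ {t b r : Bool} where
    private
      G = addColumn t b r S

    via : ∀ {w x} → (∀ v → Walk S v w) → Walk G (shift w) x → ∀ v → Walk G (shift v) x
    via walks onward v = walk-++ (shiftWalk (walks v)) onward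

    Rooted-addColumn : (∀ v → Walk G (shift v) (zero , zero)) → Walk G (zero , suc zero) (zero , zero) →
      Rooted G
    Rooted-addColumn old new₁ (zero , zero) = here
    Rooted-addColumn old new₁ (zero , suc zero) = new₁
    Rooted-addColumn old new₁ (suc i , β) = old (i , β)

    TwoRooted-addColumn : (∀ v → Walk G (shift v) (zero , zero) ⊎ Walk G (shift v) (zero , suc zero)) →
      TwoRooted G
    TwoRooted-addColumn old (zero , zero) = inj₁ here
    TwoRooted-addColumn old (zero , suc zero) = inj₂ here
    TwoRooted-addColumn old (suc i , β) = old (i , β)

    Separated-addColumn : (old : Vertex m → Bool) → (∀ {u v} → Adj S u v → old u ≡ old v) → ¬ r ≡ true →
      (∀ β → newRail t b β ≡ true → isBottom β ≡ old (zero , β)) → Separated G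
    Separated-addColumn old old-adj no-rung rail-ok =
      extendColouring isBottom old ,
      extendColouring-adj isBottom old old-adj (λ r≡true → ⊥-elim (no-rung r≡true)) rail-ok ,
      refl , refl

  CutOff-noRails : ∀ {r} → CutOff (addColumn false false r S) (suc zero , zero)
  CutOff-noRails γ w with walk-into-newColumn w
  ... | zero , _ , ()
  ... | suc zero , _ , ()

  CutOff-noTop : ∀ {b r} → Separated S → CutOff (addColumn false b r S) (suc zero , zero)
  CutOff-noTop separated γ w with walk-into-newColumn w
  ... | zero , _ , ()
  ... | suc zero , w′ , _ = Separated-walk separated w′

  CutOff-noBottom : ∀ {r} → Separated S → CutOff (addColumn true false r S) (suc zero , suc zero)
  CutOff-noBottom separated γ w with walk-into-newColumn w
  ... | suc zero , _ , ()
  ... | zero , w′ , _ = Separated-walk separated (walk-reverse w′)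

  extend-tree : ∀ c t b r → RootedTree S → Describes (extendShape (tree c) t b r) (addColumn t b r S)
  extend-tree c true true false (size≡ , rooted , acyclic) =
    trans (size-addColumn true true false S size≡) (cong suc (twice-suc m)) ,
    Rooted-addColumn (via rooted toTop) (step (bottomRail refl) (via rooted toTop (zero , suc zero))) ,
    addColumn-acyclic acyclic (λ { (_ , _ , ()) })
  extend-tree c true false true (size≡ , rooted , acyclic) =
    trans (size-addColumn true false true S size≡) (cong suc (twice-suc m)) ,
    Rooted-addColumn (via rooted toTop) acrossRung ,
    addColumn-acyclic acyclic (λ { (_ , () , _) })
  extend-tree c false true true (size≡ , rooted , acyclic) =
    trans (size-addColumn false true true S size≡) (cong suc (twice-suc m)) ,
    Rooted-addColumn (via rooted (walk-++ (shiftWalk top→bottom) (walk-++ toBottom acrossRung))) acrossRung ,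
    addColumn-acyclic acyclic (λ { (() , _ , _) })
    where top→bottom = walk-reverse (rooted (zero , suc zero))
  extend-tree c true false false (size≡ , rooted , acyclic) =
    trans (size-addColumn true false false S size≡) (twice-suc m) ,
    TwoRooted-addColumn (λ v → inj₁ (via rooted toTop v)) ,
    Separated-addColumn (λ _ → false) (λ _ → refl) (λ ()) (λ { zero _ → refl ; (suc zero) () }) ,
    addColumn-acyclic acyclic (λ { (_ , () , _) })
  extend-tree c false true false (size≡ , rooted , acyclic) =
    trans (size-addColumn false true false S size≡) (twice-suc m) ,
    TwoRooted-addColumn (λ v → inj₂ (via rooted (walk-++ (shiftWalk top→bottom) toBottom) v)) ,
    Separated-addColumn (λ _ → true) (λ _ → refl) (λ ()) (λ { zero () ; (suc zero) _ → refl }) ,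
    addColumn-acyclic acyclic (λ { (() , _ , _) })
    where top→bottom = walk-reverse (rooted (zero , suc zero))
  extend-tree c true true true (_ , rooted , _) = inj₂ (Rooted⇒addColumn-cycle rooted)
  extend-tree c false false r _ = inj₁ (_ , CutOff-noRails)

  extend-forest : ∀ d t b r → SeparatedForest S → Describes (extendShape (forest d) t b r) (addColumn t b r S)
  extend-forest d true true true (size≡ , twoRooted , separated , acyclic) =
    trans (size-addColumn true true true S size≡) (cong suc (twice-suc m)) ,
    Rooted-addColumn old acrossRung ,
    Separated⇒addColumn-acyclic acyclic separated
    where
      old : ∀ v → Walk (addColumn true true true S) (shift v) (zero , zero)
      old v with twoRooted v
      ... | inj₁ w = walk-++ (shiftWalk w) toTop
      ... | inj₂ w = walk-++ (shiftWalk w) (walk-++ toBottom acrossRung)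
  extend-forest d true true false (size≡ , twoRooted , (colour , colour-adj , colour₀₀ , colour₀₁) , acyclic) =
    trans (size-addColumn true true false S size≡) (twice-suc m) ,
    TwoRooted-addColumn (λ v → Sum.map (λ w → walk-++ (shiftWalk w) toTop) (λ w → walk-++ (shiftWalk w) toBottom)
                                        (twoRooted v)) ,
    Separated-addColumn colour colour-adj (λ ()) (λ { zero _ → sym colour₀₀ ; (suc zero) _ → sym colour₀₁ }) ,
    addColumn-acyclic acyclic (λ { (_ , _ , ()) })
  extend-forest d false b r (_ , _ , separated , _) = inj₁ (_ , CutOff-noTop separated)
  extend-forest d true false r (_ , _ , separated , _) = inj₁ (_ , CutOff-noBottom separated)

  extend-invalid : ∀ t b r → Defective S → Defective (addColumn t b r S)
  extend-invalid t b r (inj₁ (v , cut)) = inj₁ (shift v , CutOff-shift cut)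
  extend-invalid t b r (inj₂ c) = inj₂ (Cycle-shift c)

extendShape-describes : ∀ {m} {S : EdgeSet m} x t b r → Describes x S →
  Describes (extendShape x t b r) (addColumn t b r S)
extendShape-describes (tree c) = extend-tree c
extendShape-describes (forest d) = extend-forest d
extendShape-describes invalid = extend-invalid

shape-describes : ∀ {m} (S : EdgeSet m) → Describes (shape S) S
shape-describes {zero} S = shape-describes₀ S
shape-describes {suc m} (edgeSet (r ∷ rs) (t ∷ ts) (b ∷ bs)) =
  extendShape-describes (shape (edgeSet rs ts bs)) t b r (shape-describes (edgeSet rs ts bs))

treeOf : ∀ {m} → Shape m → Tree m
treeOf (tree c) = c
treeOf {m} (forest _) = junkTree m
treeOf {m} invalid = junkTree m

RootedTree⇒IsSpanningTree : ∀ {m} {S : EdgeSet m} → RootedTree S → IsSpanningTree S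
RootedTree⇒IsSpanningTree {m} (size≡ , rooted , acyclic) =
  trans size≡ (cong (_∸ 1) (twice-suc m)) , (λ u v → walk-++ (rooted u) (walk-reverse (rooted v))) , acyclic

shape-tree⇒IsSpanningTree : ∀ {m} (S : EdgeSet m) {c} → shape S ≡ tree c → IsSpanningTree S
shape-tree⇒IsSpanningTree S shape≡ with shape S | shape-describes S
shape-tree⇒IsSpanningTree S refl | tree _ | rootedTree = RootedTree⇒IsSpanningTree rootedTree

IsSpanningTree⇒shape-tree : ∀ {m} (S : EdgeSet m) → IsSpanningTree S → shape S ≡ tree (treeOf (shape S))
IsSpanningTree⇒shape-tree S (_ , connected , acyclic) with shape S | shape-describes S
... | tree _ | _ = refl
... | forest _ | (_ , _ , separated , _) = ⊥-elim (Separated-walk separated (connected _ _))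
... | invalid | inj₁ (v , cut) = ⊥-elim (cut zero (connected v _))
... | invalid | inj₂ c = ⊥-elim (acyclic c)

treeEdges-treeOf-shape : ∀ {m} (S : EdgeSet m) → IsSpanningTree S → treeEdges (treeOf (shape S)) ≡ S
treeEdges-treeOf-shape S spanning = trans (cong shapeEdges (sym shape≡tree))
  (shapeEdges-shape S (λ shape≡invalid → tree≢invalid (trans (sym shape≡tree) shape≡invalid)))
  where
    shape≡tree = IsSpanningTree⇒shape-tree S spanning
    tree≢invalid : ∀ {m} {c : Tree m} → ¬ tree c ≡ invalid
    tree≢invalid ()

SpanningTrees↔Tree : ∀ m → Inverse (SpanningTrees m) (setoid (Tree m))
SpanningTrees↔Tree m = mk↔Σ-setoid (λ S → treeOf (shape S))
  (λ c → treeEdges c , shape-tree⇒IsSpanningTree (treeEdges c) (shape-treeEdges c))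
  (λ c → cong treeOf (shape-treeEdges c))
  (treeEdges-treeOf-shape _)

theorem4p1 : (n : ℕ) → (n≥1 : 1 ≤ n) →
    Bijection (ColoredComps F2k n) (SpanningTrees (n ∸ 1)) ×
    Bijection (ColoredComps F2k n) (Words01 (n ∸ 1)) ×
    Bijection (ColoredComps F2k n) (setoid (Fin (a n)))
theorem4p1 (suc m) _ =
  Inverse⇒Bijection (Inverse.trans comps (Inverse.sym (SpanningTrees↔Tree m))) ,
  Inverse⇒Bijection (Inverse.trans comps (Inverse.sym (Words01↔Tree m))) ,
  Inverse⇒Bijection (Inverse.trans comps (Tree↔Fin-a m))
  where
    comps = ColoredComps↔Tree m
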